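{- Let $(A,\vee)$ be a join-semilattice with natural order $\le$ and greatest element $1$, and let $\to$ be a binary operation on $A$. Then $(A,\to,1)$ is a wBCK*-algebra if and only if for all $x,y,z\in A$: (1) $x\le (x\to y)\to y$; (2) $1\to x=x$; (3) $x\to(x\vee y)=1$; (4) $(x\vee y)\to z\le y\to z$.
   Context: A wBCK*-algebra is an algebra $(A,\to,1)$ where $A$ is a poset with order $\le$ and greatest element $1$, $x\le y$ iff $x\to y=1$, and for all $x,y,z$: if $x\le y\to z$ then $y\le x\to z$. -}

module Defs where

open import Level using (Level; suc; _⊔_)
open import Relation.Binary.PropositionalEquality using (_≡_)
open import Algebra.Lattice.Structures using (IsSemilattice)
open import Data.Product using (_×_)

record JoinSemilattice (a : Level) : Set (suc a) where
  field
    Carrier : Set a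
    _∨_     : Carrier → Carrier → Carrier
    isSemilattice : IsSemilattice _≡_ _∨_

  infix 4 _≤_
  _≤_ : Carrier → Carrier → Set a
  x ≤ y = (x ∨ y) ≡ y

IsGreatest : ∀ {a ℓ} {A : Set a} → (A → A → Set ℓ) → A → Set (a ⊔ ℓ)
IsGreatest _≤_ t = ∀ x → x ≤ t

record IsWBCK* {a ℓ} {A : Set a} (_≤_ : A → A → Set ℓ)
               (_⇒_ : A → A → A) (one : A) : Set (a ⊔ ℓ) where
  field
    greatest : IsGreatest _≤_ one
    ≤⇒⇒≡1   : ∀ {x y} → x ≤ y → (x ⇒ y) ≡ one
    ⇒≡1⇒≤   : ∀ {x y} → (x ⇒ y) ≡ one → x ≤ y
    exchange : ∀ {x y z} → x ≤ (y ⇒ z) → y ≤ (x ⇒ z)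

-- Over any preordered set (A, ≤) with a binary operation ⇒, the exchange
-- law  x ≤ y ⇒ z  ⟹  y ≤ x ⇒ z  is equivalent to the conjunction of
--   modus ponens   x ≤ (x ⇒ y) ⇒ y,   and
--   antitonicity   x ≤ y  ⟹  y ⇒ z ≤ x ⇒ z.
-- This equivalence (module WBCKOrder) carries the whole proof: on a
-- join-semilattice, condition (1) is modus ponens, condition (4) is
-- antitonicity restricted to the pairs y ≤ x ∨ y (which is no restriction,
-- since u ≤ v means v = u ∨ v), and conditions (2) and (3) are exactly what
-- is needed to turn "x ⇒ y = 1 iff x ≤ y" into equations in the semilattice.

module Submission where

open import Defs
open import Level using (Level)
open import Data.Product using (_×_; _,_)
open import Function.Bundles using (_⇔_; mk⇔)
open import Relation.Binary.Core using (Rel)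
open import Relation.Binary.Structures using (IsPreorder; IsPartialOrder)
open import Relation.Binary.PropositionalEquality
  using (_≡_; refl; sym; trans; cong; subst; isEquivalence)
open import Algebra.Core using (Op₂)
open import Algebra.Structures using (IsCommutativeBand)
import Relation.Binary.Construct.NaturalOrder.Right as RightOrder

-- It is the converse of the library's right natural order (y = x ∨ y),
-- from which reflexivity, transitivity and antisymmetry are inherited.
module NaturalOrder {a : Level} (L : JoinSemilattice a) where
  open JoinSemilattice L
  open IsCommutativeBand isSemilattice using (assoc; comm; idem; isSemigroup)
  private module R = RightOrder _≡_ _∨_

  ≤-isPartialOrder : IsPartialOrder _≡_ _≤_
  ≤-isPartialOrder = record
    { isPreorder = record
      { isEquivalence = isEquivalence
      ; reflexive     = λ { refl → idem _ }
      ; trans         = λ x≤y y≤z → sym (R.trans isSemigroup (sym y≤z) (sym x≤y))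
      }
    ; antisym = λ x≤y y≤x → R.antisym isEquivalence comm (sym y≤x) (sym x≤y)
    }

  x≤x∨y : ∀ x y → x ≤ (x ∨ y)
  x≤x∨y x y = trans (sym (assoc x x y)) (cong (_∨ y) (idem x))

  y≤x∨y : ∀ x y → y ≤ (x ∨ y)
  y≤x∨y x y = subst (y ≤_) (comm y x) (x≤x∨y y x)

module WBCKOrder {a ℓ} {A : Set a} {_≤_ : Rel A ℓ}
                 (≤-isPreorder : IsPreorder _≡_ _≤_) (_⇒_ : Op₂ A) where
  open IsPreorder ≤-isPreorder using (reflexive) renaming (trans to ≤-trans)

  ModusPonens : Set _
  ModusPonens = ∀ x y → x ≤ ((x ⇒ y) ⇒ y)

  Antitone : Set _
  Antitone = ∀ {x y} z → x ≤ y → (y ⇒ z) ≤ (x ⇒ z)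

  Exchange : Set _
  Exchange = ∀ {x y z} → x ≤ (y ⇒ z) → y ≤ (x ⇒ z)

  -- Exchanging the reflexive instance  x ⇒ y ≤ x ⇒ y.
  exchange⇒modusPonens : Exchange → ModusPonens
  exchange⇒modusPonens exchange x y = exchange (reflexive refl)

  -- From x ≤ y ≤ (y ⇒ z) ⇒ z, exchange gives y ⇒ z ≤ x ⇒ z.
  exchange⇒antitone : Exchange → Antitone
  exchange⇒antitone exchange {x} {y} z x≤y =
    exchange (≤-trans x≤y (exchange⇒modusPonens exchange y z))

  -- From x ≤ y ⇒ z, antitonicity gives (y ⇒ z) ⇒ z ≤ x ⇒ z, and y lies below
  -- the former by modus ponens.
  modusPonens×antitone⇒exchange : ModusPonens → Antitone → Exchange
  modusPonens×antitone⇒exchange mp antitone {x} {y} {z} x≤y⇒z =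
    ≤-trans (mp y z) (antitone z x≤y⇒z)

  -- In a wBCK*-algebra over a partial order, 1 is a left unit of ⇒:
  -- one ⇒ x ≤ x because (one ⇒ x) ⇒ x lies above one, hence equals one;
  -- x ≤ one ⇒ x by exchanging one = x ⇒ x ≤ x ⇒ x.
  one⇒x≡x : ∀ {one} → (∀ {x y} → x ≤ y → y ≤ x → x ≡ y) →
            IsWBCK* _≤_ _⇒_ one → ∀ x → (one ⇒ x) ≡ x
  one⇒x≡x {one} antisym W x = antisym one⇒x≤x x≤one⇒x
    where
    open IsWBCK* W
    one⇒x≤x : (one ⇒ x) ≤ x
    one⇒x≤x = ⇒≡1⇒≤ (antisym (greatest _) (exchange⇒modusPonens exchange one x))
    x≤one⇒x : x ≤ (one ⇒ x)
    x≤one⇒x = exchange (reflexive (sym (≤⇒⇒≡1 (reflexive refl))))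

module Characterisation {a : Level} (L : JoinSemilattice a)
                        (one : JoinSemilattice.Carrier L)
                        (one-greatest : IsGreatest (JoinSemilattice._≤_ L) one)
                        (_⇒_ : Op₂ (JoinSemilattice.Carrier L)) where
  open JoinSemilattice L
  open IsCommutativeBand isSemilattice using (comm)
  open NaturalOrder L
  open IsPartialOrder ≤-isPartialOrder using (isPreorder; antisym)
  open WBCKOrder isPreorder _⇒_

  Conditions : Set a
  Conditions = (∀ x y → x ≤ ((x ⇒ y) ⇒ y))
             × (∀ x → (one ⇒ x) ≡ x)
             × (∀ x y → (x ⇒ (x ∨ y)) ≡ one)
             × (∀ x y z → ((x ∨ y) ⇒ z) ≤ (y ⇒ z))

  wbck⇒conditions : IsWBCK* _≤_ _⇒_ one → Conditions
  wbck⇒conditions W =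
      exchange⇒modusPonens exchange
    , one⇒x≡x antisym W
    , (λ x y → ≤⇒⇒≡1 (x≤x∨y x y))
    , (λ x y z → exchange⇒antitone exchange z (y≤x∨y x y))
    where open IsWBCK* W

  conditions⇒wbck : Conditions → IsWBCK* _≤_ _⇒_ one
  conditions⇒wbck (mp , one-left-unit , x⇒x∨y≡one , join-antitone) = record
    { greatest = one-greatest
    ; ≤⇒⇒≡1   = ≤⇒⇒≡1
    ; ⇒≡1⇒≤   = ⇒≡1⇒≤
    ; exchange = modusPonens×antitone⇒exchange mp antitone
    }
    where
    -- If x ≤ y then y = x ∨ y, so x ⇒ y = x ⇒ (x ∨ y) = 1 by (3).
    ≤⇒⇒≡1 : ∀ {x y} → x ≤ y → (x ⇒ y) ≡ one
    ≤⇒⇒≡1 {x} x≤y = trans (cong (x ⇒_) (sym x≤y)) (x⇒x∨y≡one x _)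

    -- If x ⇒ y = 1 then (x ⇒ y) ⇒ y = 1 ⇒ y = y by (2), so x ≤ y by (1).
    ⇒≡1⇒≤ : ∀ {x y} → (x ⇒ y) ≡ one → x ≤ y
    ⇒≡1⇒≤ {x} {y} x⇒y≡one =
      subst (x ≤_) (trans (cong (_⇒ y) x⇒y≡one) (one-left-unit y)) (mp x y)

    -- If x ≤ y then y = y ∨ x, and (4) gives (y ∨ x) ⇒ z ≤ x ⇒ z.
    antitone : Antitone
    antitone {x} {y} z x≤y =
      subst (λ w → (w ⇒ z) ≤ (x ⇒ z)) (trans (comm y x) x≤y) (join-antitone y x z)

theorem5p1 : ∀ {a : Level} (L : JoinSemilattice a) →
    let open JoinSemilattice L in
    (one : Carrier) → IsGreatest _≤_ one → (_⇒_ : Carrier → Carrier → Carrier) →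
    IsWBCK* _≤_ _⇒_ one ⇔
      ((∀ x y → x ≤ ((x ⇒ y) ⇒ y))
      × (∀ x → (one ⇒ x) ≡ x)
      × (∀ x y → (x ⇒ (x ∨ y)) ≡ one)
      × (∀ x y z → ((x ∨ y) ⇒ z) ≤ (y ⇒ z)))
theorem5p1 L one one-greatest _⇒_ = mk⇔ wbck⇒conditions conditions⇒wbck
  where open Characterisation L one one-greatest _⇒_
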